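{- For any derivation of a sequent $S \mid \Gamma \vdash C$ in the skew monoidal sequent calculus, there is a focused derivation of $S \mid \Gamma \vdash_{\mathsf L} C$.
   Context: Fix a set $\mathrm{Var}$ of atoms. Formulae: atoms $X \in \mathrm{Var}$, $\mathsf{I}$, and $A \otimes B$ for formulae $A, B$. A context is a finite list of formulae; a stoup $S$ is either empty (written $-$) or a single formula; a stoup $T$ is irreducible if $T = -$ or $T$ is an atom. Skew monoidal sequent calculus: sequents $S \mid \Gamma \vdash C$ derived by (ax) $A \mid\ \vdash A$; (pass) from $A \mid \Gamma \vdash C$ infer $- \mid A, \Gamma \vdash C$; (scut) from $S \mid \Gamma \vdash A$ and $A \mid \Delta \vdash C$ infer $S \mid \Gamma, \Delta \vdash C$; (ccut) from $- \mid \Gamma \vdash A$ and $S \mid \Delta_0, A, \Delta_1 \vdash C$ infer $S \mid \Delta_0, \Gamma, \Delta_1 \vdash C$; ($\mathsf I$L) from $- \mid \Gamma \vdash C$ infer $\mathsf I \mid \Gamma \vdash C$; ($\mathsf I$R) $- \mid\ \vdash \mathsf I$; ($\otimes$L) from $A \mid B, \Gamma \vdash C$ infer $A \otimes B \mid \Gamma \vdash C$; ($\otimes$R) from $S \mid \Gamma \vdash A$ and $- \mid \Delta \vdash B$ infer $S \mid \Gamma, \Delta \vdash A \otimes B$. Focused calculus: sequents $S \mid \Gamma \vdash_{\mathsf L} C$ and $T \mid \Gamma \vdash_{\mathsf R} C$ ($T$ irreducible), derived by: (pass) from $A \mid \Gamma \vdash_{\mathsf L} C$ infer $- \mid A, \Gamma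 \vdash_{\mathsf L} C$; (switch) from $T \mid \Gamma \vdash_{\mathsf R} C$ infer $T \mid \Gamma \vdash_{\mathsf L} C$; (ax) $X \mid\ \vdash_{\mathsf R} X$ for atoms $X$; ($\mathsf I$L) from $- \mid \Gamma \vdash_{\mathsf L} C$ infer $\mathsf I \mid \Gamma \vdash_{\mathsf L} C$; ($\mathsf I$R) $- \mid\ \vdash_{\mathsf R} \mathsf I$; ($\otimes$L) from $A \mid B, \Gamma \vdash_{\mathsf L} C$ infer $A \otimes B \mid \Gamma \vdash_{\mathsf L} C$; ($\otimes$R) from $T \mid \Gamma \vdash_{\mathsf R} A$ and $- \mid \Delta \vdash_{\mathsf L} B$ infer $T \mid \Gamma, \Delta \vdash_{\mathsf R} A \otimes B$. -}

module Defs where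

open import Data.List using (List; []; _∷_; _++_)
open import Data.Maybe using (Maybe; nothing; just)

data Fma (Var : Set) : Set where
  ` : Var → Fma Var
  I : Fma Var
  _⊗_ : Fma Var → Fma Var → Fma Var

infixr 30 _⊗_
infix 3 _∣_⊢_ _∣_⊢L_ _∣_⊢R_

-- Contexts and stoups (nothing = empty stoup "-")
Cxt : Set → Set
Cxt Var = List (Fma Var)

Stp : Set → Set
Stp Var = Maybe (Fma Var)

data Irr {Var : Set} : Stp Var → Set where
  irr-  : Irr nothing
  irr-` : (X : Var) → Irr (just (` X))

data _∣_⊢_ {Var : Set} : Stp Var → Cxt Var → Fma Var → Set where
  ax   : {A : Fma Var} → just A ∣ [] ⊢ A
  pass : {Γ : Cxt Var} {A C : Fma Var} →
         just A ∣ Γ ⊢ C → nothing ∣ A ∷ Γ ⊢ C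
  scut : {S : Stp Var} {Γ Δ : Cxt Var} {A C : Fma Var} →
         S ∣ Γ ⊢ A → just A ∣ Δ ⊢ C → S ∣ Γ ++ Δ ⊢ C
  ccut : {S : Stp Var} {Γ Δ₀ Δ₁ : Cxt Var} {A C : Fma Var} →
         nothing ∣ Γ ⊢ A → S ∣ Δ₀ ++ A ∷ Δ₁ ⊢ C →
         S ∣ Δ₀ ++ Γ ++ Δ₁ ⊢ C
  IL   : {Γ : Cxt Var} {C : Fma Var} →
         nothing ∣ Γ ⊢ C → just I ∣ Γ ⊢ C
  IR   : nothing ∣ [] ⊢ I
  ⊗L   : {Γ : Cxt Var} {A B C : Fma Var} →
         just A ∣ B ∷ Γ ⊢ C → just (A ⊗ B) ∣ Γ ⊢ C
  ⊗R   : {S : Stp Var} {Γ Δ : Cxt Var} {A B : Fma Var} →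
         S ∣ Γ ⊢ A → nothing ∣ Δ ⊢ B → S ∣ Γ ++ Δ ⊢ A ⊗ B

mutual
  data _∣_⊢L_ {Var : Set} : Stp Var → Cxt Var → Fma Var → Set where
    pass   : {Γ : Cxt Var} {A C : Fma Var} →
             just A ∣ Γ ⊢L C → nothing ∣ A ∷ Γ ⊢L C
    switch : {T : Stp Var} {Γ : Cxt Var} {C : Fma Var} →
             Irr T → T ∣ Γ ⊢R C → T ∣ Γ ⊢L C
    IL     : {Γ : Cxt Var} {C : Fma Var} →
             nothing ∣ Γ ⊢L C → just I ∣ Γ ⊢L C
    ⊗L     : {Γ : Cxt Var} {A B C : Fma Var} →
             just A ∣ B ∷ Γ ⊢L C → just (A ⊗ B) ∣ Γ ⊢L C

  data _∣_⊢R_ {Var : Set} : Stp Var → Cxt Var → Fma Var → Set where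
    ax : {X : Var} → just (` X) ∣ [] ⊢R ` X
    IR : nothing ∣ [] ⊢R I
    ⊗R : {T : Stp Var} {Γ Δ : Cxt Var} {A B : Fma Var} →
         Irr T → T ∣ Γ ⊢R A → nothing ∣ Δ ⊢L B → T ∣ Γ ++ Δ ⊢R A ⊗ B

-- Every rule of the unfocused calculus is admissible in the focused one.
-- Axioms are η-expanded, and ⊗R is pushed below the left rules of its first
-- premise.  The two cuts are eliminated by a simultaneous induction on the cut
-- formula and then on the derivations: a stoup cut descends through the left
-- premise until it reaches its R-phase, where a principal ⊗R/⊗L pair on A ⊗ B
-- reduces to a context cut on B followed by a stoup cut on A; a context cut
-- descends through the right premise, into whichever half of a ⊗R contains
-- the cut formula, and becomes a stoup cut once the formula is passed.
module Submission where

open import Defs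
open import Data.List using (List; []; _∷_; _++_)
open import Data.List.Properties using (++-assoc; ∷-injective)
open import Data.Maybe using (nothing; just)
open import Data.Product using (_,_)
open import Relation.Binary.PropositionalEquality
  using (_≡_; refl; sym; trans; cong; subst)

data ++-∷-Split {a} {X : Set a} (Γ Δ Δ₀ : List X) (x : X) (Δ₁ : List X) : Set a where
  in-left  : ∀ Ω → Γ ≡ Δ₀ ++ x ∷ Ω → Δ₁ ≡ Ω ++ Δ → ++-∷-Split Γ Δ Δ₀ x Δ₁
  in-right : ∀ Ω → Δ ≡ Ω ++ x ∷ Δ₁ → Δ₀ ≡ Γ ++ Ω → ++-∷-Split Γ Δ Δ₀ x Δ₁

++-∷-split : ∀ {a} {X : Set a} (Γ Δ Δ₀ : List X) {x : X} (Δ₁ : List X) →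
  Γ ++ Δ ≡ Δ₀ ++ x ∷ Δ₁ → ++-∷-Split Γ Δ Δ₀ x Δ₁
++-∷-split []      Δ Δ₀       Δ₁ eq   = in-right Δ₀ eq refl
++-∷-split (y ∷ Γ) Δ []       Δ₁ refl = in-left Γ refl refl
++-∷-split (y ∷ Γ) Δ (z ∷ Δ₀) Δ₁ eq with ∷-injective eq
... | refl , eq′ with ++-∷-split Γ Δ Δ₀ Δ₁ eq′
...   | in-left  Ω e₁ e₂ = in-left  Ω (cong (y ∷_) e₁) e₂
...   | in-right Ω e₁ e₂ = in-right Ω e₁ (cong (y ∷_) e₂)

module _ {Var : Set} where

  castL : {S : Stp Var} {Γ Γ′ : Cxt Var} {C : Fma Var} →
    Γ ≡ Γ′ → S ∣ Γ ⊢L C → S ∣ Γ′ ⊢L C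
  castL {S} {C = C} = subst (λ Γ → S ∣ Γ ⊢L C)

  ⊗RL : {S : Stp Var} {Γ Δ : Cxt Var} {A B : Fma Var} →
    S ∣ Γ ⊢L A → nothing ∣ Δ ⊢L B → S ∣ Γ ++ Δ ⊢L A ⊗ B
  ⊗RL (pass f)     g = pass (⊗RL f g)
  ⊗RL (switch t f) g = switch t (⊗R t f g)
  ⊗RL (IL f)       g = IL (⊗RL f g)
  ⊗RL (⊗L f)       g = ⊗L (⊗RL f g)

  axL : (A : Fma Var) → just A ∣ [] ⊢L A
  axL (` X)   = switch (irr-` X) ax
  axL I       = IL (switch irr- IR)
  axL (A ⊗ B) = ⊗L (⊗RL (axL A) (pass (axL B)))

  mutual
    scutL : (A : Fma Var) {S : Stp Var} {Γ Δ : Cxt Var} {C : Fma Var} →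
      S ∣ Γ ⊢L A → just A ∣ Δ ⊢L C → S ∣ Γ ++ Δ ⊢L C
    scutL A (pass f)     g = pass (scutL A f g)
    scutL A (switch t f) g = scutR A t f g
    scutL A (IL f)       g = IL (scutL A f g)
    scutL A (⊗L f)       g = ⊗L (scutL A f g)

    scutR : (A : Fma Var) {T : Stp Var} {Γ Δ : Cxt Var} {C : Fma Var} →
      Irr T → T ∣ Γ ⊢R A → just A ∣ Δ ⊢L C → T ∣ Γ ++ Δ ⊢L C
    scutR _ t ax g = g
    scutR _ t IR (switch () _)
    scutR _ t IR (IL g) = g
    scutR _ t (⊗R _ _ _) (switch () _)
    scutR _ t (⊗R {Γ = Γ₁} {Γ₂} {A} {B} _ f₁ f₂) (⊗L {Γ = Δ} g) =
      castL (sym (++-assoc Γ₁ Γ₂ Δ)) (ccutL B Γ₁ Δ f₂ (scutR A t f₁ g) refl)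

    ccutL : (A : Fma Var) {S : Stp Var} {Γ Δ : Cxt Var} (Δ₀ Δ₁ : Cxt Var) {C : Fma Var} →
      nothing ∣ Γ ⊢L A → S ∣ Δ ⊢L C → Δ ≡ Δ₀ ++ A ∷ Δ₁ → S ∣ Δ₀ ++ Γ ++ Δ₁ ⊢L C
    ccutL A []       Δ₁ f (pass g)     refl = scutL A f g
    ccutL A (_ ∷ Δ₀) Δ₁ f (pass g)     refl = pass (ccutL A Δ₀ Δ₁ f g refl)
    ccutL A Δ₀       Δ₁ f (switch t g) eq   = ccutR A Δ₀ Δ₁ f t g eq
    ccutL A Δ₀       Δ₁ f (IL g)       eq   = IL (ccutL A Δ₀ Δ₁ f g eq)
    ccutL A Δ₀       Δ₁ f (⊗L {B = B} g) refl = ⊗L (ccutL A (B ∷ Δ₀) Δ₁ f g refl)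

    ccutR : (A : Fma Var) {T : Stp Var} {Γ Δ : Cxt Var} (Δ₀ Δ₁ : Cxt Var) {C : Fma Var} →
      nothing ∣ Γ ⊢L A → Irr T → T ∣ Δ ⊢R C → Δ ≡ Δ₀ ++ A ∷ Δ₁ → T ∣ Δ₀ ++ Γ ++ Δ₁ ⊢L C
    ccutR A []      Δ₁ f t ax ()
    ccutR A (_ ∷ _) Δ₁ f t ax ()
    ccutR A []      Δ₁ f t IR ()
    ccutR A (_ ∷ _) Δ₁ f t IR ()
    ccutR A {Γ = Γ} Δ₀ Δ₁ f t (⊗R {Γ = Δa} {Δb} _ g₁ g₂) eq
      with ++-∷-split Δa Δb Δ₀ Δ₁ eq
    ... | in-left Ω refl refl =
      castL (trans (++-assoc Δ₀ (Γ ++ Ω) Δb) (cong (Δ₀ ++_) (++-assoc Γ Ω Δb)))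
        (⊗RL (ccutR A Δ₀ Ω f t g₁ refl) g₂)
    ... | in-right Ω refl refl =
      castL (sym (++-assoc Δa Ω (Γ ++ Δ₁)))
        (switch t (⊗R t g₁ (ccutL A Ω Δ₁ f g₂ refl)))

theorem5p2 : {Var : Set} {S : Stp Var} {Γ : Cxt Var} {C : Fma Var} →
    S ∣ Γ ⊢ C → S ∣ Γ ⊢L C
theorem5p2 ax         = axL _
theorem5p2 (pass f)   = pass (theorem5p2 f)
theorem5p2 (scut f g) = scutL _ (theorem5p2 f) (theorem5p2 g)
theorem5p2 (ccut {Δ₀ = Δ₀} {Δ₁} f g) = ccutL _ Δ₀ Δ₁ (theorem5p2 f) (theorem5p2 g) refl
theorem5p2 (IL f)     = IL (theorem5p2 f)
theorem5p2 IR         = switch irr- IR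
theorem5p2 (⊗L f)     = ⊗L (theorem5p2 f)
theorem5p2 (⊗R f g)   = ⊗RL (theorem5p2 f) (theorem5p2 g)
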